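{- An instance of deadline-scheduling-with-processor-bounds is feasible if and only if $\mathrm{def}(Q) \le 0$ and $\mathrm{exc}(Q) \le 0$ for every $Q \subseteq T$.
   Context: There are $m$ processors and a set $J$ of jobs with integer release times $r_j$, deadlines $d_j$ and processing volumes $p_j$; time slots $T=\{0,\dots,d\}$; $E_j = \{t \in T: r_j \le t \le d_j\}$. A feasible schedule assigns to each processor and time slot at most one job such that each job $j$ occupies exactly $p_j$ distinct slots of $E_j$ and never runs on two processors in the same slot; $\mathrm{vol}(t)$ is the number of busy processors at $t$. An instance of deadline-scheduling-with-processor-bounds additionally specifies integers $0\le l_t\le m_t\le m$ for $t\in T$, and is feasible if there is a feasible schedule with $l_t \le \mathrm{vol}(t) \le m_t$ for all $t$. For $Q\subseteq T$: $\mathrm{fv}(Q) = \sum_{j}\max\{0, p_j - |E_j\setminus Q|\}$, $\mathrm{pv}(Q) = \sum_j \min\{p_j, |E_j\cap Q|\}$, $\mathrm{def}(Q) = \mathrm{fv}(Q) - \sum_{t\in Q} m_t$, $\mathrm{exc}(Q) = \sum_{t \in Q} l_t - \mathrm{pv}(Q)$. -}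

module Defs where

open import Data.Nat using (ℕ; _+_; _∸_; _⊓_; _≤_; _≤ᵇ_)
open import Data.Fin using (Fin; toℕ; zero; suc; _≟_)
open import Relation.Nullary.Decidable.Core using (does)
open import Data.Fin.Subset using (Subset; _∈_; _∉_)
open import Data.Bool using (Bool; true; false; if_then_else_; _∧_; not)
open import Data.Maybe using (Maybe; just; nothing; is-just; maybe)
open import Data.Product using (_×_; Σ)
open import Relation.Binary.PropositionalEquality using (_≡_)
import Data.Vec as V
import Data.Nat

Σ[_] : ∀ {k} → (Fin k → ℕ) → ℕ
Σ[_] {Data.Nat.zero} f = 0
Σ[_] {Data.Nat.suc k} f = f zero + Σ[_] (λ i → f (suc i))

count : ∀ {k} → (Fin k → Bool) → ℕ
count b = Σ[ (λ i → if b i then 1 else 0) ]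

anyᵇ : ∀ {k} → (Fin k → Bool) → Bool
anyᵇ {Data.Nat.zero} f = false
anyᵇ {Data.Nat.suc k} f = if f zero then true else anyᵇ (λ i → f (suc i))

-- An instance: m processors, time slots T = {0,…,d} represented by Fin (Data.Nat.suc d),
-- n jobs represented by Fin n.
record Instance : Set where
  field
    m d n : ℕ
    r dl p : Fin n → ℕ          -- release time, deadline, processing volume
    lo hi : Fin (Data.Nat.suc d) → ℕ
    lo≤hi : ∀ t → lo t ≤ hi t
    hi≤m  : ∀ t → hi t ≤ m

module _ (I : Instance) where
  open Instance I

  Slot = Fin (Data.Nat.suc d)

  inEᵇ : Fin n → Slot → Bool
  inEᵇ j t = (r j ≤ᵇ toℕ t) ∧ (toℕ t ≤ᵇ dl j)

  inQᵇ : Subset (Data.Nat.suc d) → Slot → Bool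
  inQᵇ Q t = V.lookup Q t

  fv : Subset (Data.Nat.suc d) → ℕ
  fv Q = Σ[ (λ j → p j ∸ count (λ t → inEᵇ j t ∧ not (inQᵇ Q t))) ]

  pv : Subset (Data.Nat.suc d) → ℕ
  pv Q = Σ[ (λ j → p j ⊓ count (λ t → inEᵇ j t ∧ inQᵇ Q t)) ]

  hiSum : Subset (Data.Nat.suc d) → ℕ
  hiSum Q = Σ[ (λ t → if inQᵇ Q t then hi t else 0) ]

  loSum : Subset (Data.Nat.suc d) → ℕ
  loSum Q = Σ[ (λ t → if inQᵇ Q t then lo t else 0) ]

  -- def(Q) ≤ 0  and  exc(Q) ≤ 0  (stated without integer subtraction)
  def≤0 : Subset (Data.Nat.suc d) → Set
  def≤0 Q = fv Q ≤ hiSum Q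

  exc≤0 : Subset (Data.Nat.suc d) → Set
  exc≤0 Q = loSum Q ≤ pv Q

  Schedule : Set
  Schedule = Fin m → Slot → Maybe (Fin n)

  runsᵇ : Schedule → Fin n → Slot → Bool
  runsᵇ S j t = anyᵇ (λ i → maybe (λ j' → does (j ≟ j')) false (S i t))

  vol : Schedule → Slot → ℕ
  vol S t = count (λ i → is-just (S i t))

  record FeasibleSchedule (S : Schedule) : Set where
    field
      noParallel : ∀ t i i' j → S i t ≡ just j → S i' t ≡ just j → i ≡ i'
      inWindow   : ∀ i t j → S i t ≡ just j → r j ≤ toℕ t × toℕ t ≤ dl j
      volume     : ∀ j → count (runsᵇ S j) ≡ p j
      lowerBound : ∀ t → lo t ≤ vol S t
      upperBound : ∀ t → vol S t ≤ hi t

  Feasible : Set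
  Feasible = Σ Schedule FeasibleSchedule

-- A feasible schedule is the same thing as a 0/1 job-slot incidence x whose rows have
-- sums p_j and lie inside the windows E_j and whose column sums (loads) lie between l_t
-- and m_t: the jobs of one slot can be packed onto distinct processors. For such an x and
-- any Q, each job runs inside Q at least p_j - |E_j \ Q| and at most min{p_j, |E_j ∩ Q|}
-- times, so fv(Q) ≤ load(Q) ≤ Σ_Q m_t and Σ_Q l_t ≤ load(Q) ≤ pv(Q).
-- Conversely, start from any incidence with the right rows (def(∅) ≤ 0 gives p_j ≤ |E_j|)
-- and repair the upper bounds by augmenting paths in the exchange graph, which has an edge
-- u → v when some job running at u may run at v instead. Moving one job along each edge of
-- a simple path from an overloaded slot to a slot below its bound lowers the total
-- overload. If there is no such path, the set Q of slots reachable from the overloaded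
-- ones is closed, so every job runs inside Q only as often as its window forces it to:
-- load(Q) ≤ fv(Q). As Q contains an overloaded slot and none below its bound, def(Q) > 0.
-- The lower bounds are repaired in the same way along reversed paths, using exc, without
-- breaking the upper bounds.

module Submission where

open import Defs
open import Data.Fin.Subset using (Subset)
open import Data.Nat using (suc)
open import Data.Product using (_×_)
open import Function.Bundles using (_⇔_)

open import Data.Bool using (Bool; true; false; if_then_else_; _∧_; _∨_; not)
import Data.Bool as Bool
open import Data.Bool.Properties
  using (∨-zeroʳ; ∧-identityʳ; ∧-zeroʳ; ∧-conicalˡ; ∧-conicalʳ; T-≡; ⇔→≡)
open import Data.Empty using (⊥-elim)
open import Data.Fin using (Fin; zero; suc; _≟_; toℕ)
open import Data.Fin.Properties using (suc-injective; any?)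
open import Data.List using (List; []; _∷_)
open import Data.List.Membership.Propositional using (_∈_; _∉_)
open import Data.List.Relation.Unary.Any using (here; there)
open import Data.Maybe using (Maybe; just; nothing; is-just; maybe)
import Data.Maybe as Maybe
open import Data.Nat using (ℕ; zero; _+_; _∸_; _⊓_; _≤_; _<_; _<?_; z≤n)
open import Data.Nat.Properties hiding (suc-injective; _≟_)
open import Algebra.Properties.CommutativeSemigroup +-commutativeSemigroup
  using (xy∙z≈xz∙y; xy∙z≈zy∙x; x∙yz≈xz∙y)
import Algebra.Properties.CommutativeMonoid.Sum +-0-commutativeMonoid as Sum
open import Data.Product using (∃; ∃-syntax; _,_; proj₁; proj₂)
open import Data.Vec using (lookup; tabulate)
open import Data.Vec.Properties using (lookup∘tabulate)
open import Data.Vec.Functional using (updateAt)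
open import Data.Vec.Functional.Properties using (updateAt-updates; updateAt-minimal)
open import Function using (_∘_; const; flip; id)
open import Function.Bundles using (mk⇔; Equivalence)
open import Function.Properties.Equivalence using () renaming (trans to ⇔-trans)
open import Relation.Binary.Construct.Closure.ReflexiveTransitive using (Star; ε; _◅_; _◅◅_; reverse)
open import Relation.Binary.PropositionalEquality
open import Relation.Nullary using (¬_; Dec; yes; no; contradiction)
open import Relation.Nullary.Decidable using (does; _×-dec_; dec-true; dec-false)

bit : Bool → ℕ
bit b = if b then 1 else 0

Σ-cong : ∀ {k} {f g : Fin k → ℕ} → f ≗ g → Σ[ f ] ≡ Σ[ g ]
Σ-cong {zero}  f≗g = refl
Σ-cong {suc k} f≗g = cong₂ _+_ (f≗g zero) (Σ-cong (f≗g ∘ suc))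

Σ-zero : ∀ {k} → Σ[ (λ (_ : Fin k) → 0) ] ≡ 0
Σ-zero {zero}  = refl
Σ-zero {suc k} = Σ-zero {k}

Σ-mono-≤ : ∀ {k} {f g : Fin k → ℕ} → (∀ i → f i ≤ g i) → Σ[ f ] ≤ Σ[ g ]
Σ-mono-≤ {zero}  f≤g = z≤n
Σ-mono-≤ {suc k} f≤g = +-mono-≤ (f≤g zero) (Σ-mono-≤ (f≤g ∘ suc))

Σ-mono-< : ∀ {k} {f g : Fin k → ℕ} → (∀ i → f i ≤ g i) → ∀ i → f i < g i → Σ[ f ] < Σ[ g ]
Σ-mono-< f≤g zero    fi<gi = +-mono-<-≤ fi<gi (Σ-mono-≤ (f≤g ∘ suc))
Σ-mono-< f≤g (suc i) fi<gi = +-mono-≤-< (f≤g zero) (Σ-mono-< (f≤g ∘ suc) i fi<gi)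

term≤Σ : ∀ {k} (f : Fin k → ℕ) i → f i ≤ Σ[ f ]
term≤Σ f zero    = m≤m+n _ _
term≤Σ f (suc i) = ≤-trans (term≤Σ (f ∘ suc) i) (m≤n+m _ _)

Σ∸≤0⇒≤ : ∀ {k} (f g : Fin k → ℕ) → Σ[ (λ t → f t ∸ g t) ] ≤ 0 → ∀ t → f t ≤ g t
Σ∸≤0⇒≤ f g Σ≤0 t = m∸n≡0⇒m≤n (n≤0⇒n≡0 (≤-trans (term≤Σ (λ t → f t ∸ g t) t) Σ≤0))

Σ≡sum : ∀ {k} (f : Fin k → ℕ) → Σ[ f ] ≡ Sum.sum f
Σ≡sum {zero}  f = refl
Σ≡sum {suc k} f = cong (f zero +_) (Σ≡sum (f ∘ suc))

Σ-distrib-+ : ∀ {k} (f g : Fin k → ℕ) → Σ[ (λ i → f i + g i) ] ≡ Σ[ f ] + Σ[ g ]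
Σ-distrib-+ f g = begin
  Σ[ (λ i → f i + g i) ]  ≡⟨ Σ≡sum (λ i → f i + g i) ⟩
  Sum.sum (λ i → f i + g i) ≡⟨ Sum.∑-distrib-+ f g ⟩
  Sum.sum f + Sum.sum g   ≡⟨ cong₂ _+_ (Σ≡sum f) (Σ≡sum g) ⟨
  Σ[ f ] + Σ[ g ]         ∎
  where open ≡-Reasoning

Σ-swap : ∀ {k l} (f : Fin k → Fin l → ℕ) →
         Σ[ (λ i → Σ[ f i ]) ] ≡ Σ[ (λ j → Σ[ (λ i → f i j) ]) ]
Σ-swap {zero}  {l} f = sym (Σ-zero {l})
Σ-swap {suc k}     f = begin
  Σ[ f zero ] + Σ[ (λ i → Σ[ f (suc i) ]) ]            ≡⟨ cong (Σ[ f zero ] +_) (Σ-swap (f ∘ suc)) ⟩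
  Σ[ f zero ] + Σ[ (λ j → Σ[ (λ i → f (suc i) j) ]) ]  ≡⟨ Σ-distrib-+ (f zero) _ ⟨
  Σ[ (λ j → f zero j + Σ[ (λ i → f (suc i) j) ]) ]     ∎
  where open ≡-Reasoning

count-cong : ∀ {k} {b c : Fin k → Bool} → b ≗ c → count b ≡ count c
count-cong b≗c = Σ-cong (cong bit ∘ b≗c)

count-none : ∀ {k} {b : Fin k → Bool} → (∀ i → b i ≡ false) → count b ≡ 0
count-none {k} b≗false = trans (count-cong b≗false) (Σ-zero {k})

count≤ : ∀ {k} (b : Fin k → Bool) → count b ≤ k
count≤ {zero}  b = z≤n
count≤ {suc k} b = +-mono-≤ (bit≤1 (b zero)) (count≤ (b ∘ suc))
  where
  bit≤1 : ∀ x → bit x ≤ 1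
  bit≤1 true  = ≤-refl
  bit≤1 false = z≤n

count-mono : ∀ {k} {b c : Fin k → Bool} → (∀ i → b i ≡ true → c i ≡ true) → count b ≤ count c
count-mono b⊆c = Σ-mono-≤ (λ i → bit-mono (b⊆c i))
  where
  bit-mono : ∀ {x y} → (x ≡ true → y ≡ true) → bit x ≤ bit y
  bit-mono {true}  x⊆y rewrite x⊆y refl = ≤-refl
  bit-mono {false} x⊆y = z≤n

count-split : ∀ {k} (b c : Fin k → Bool) →
              count b ≡ count (λ i → b i ∧ c i) + count (λ i → b i ∧ not (c i))
count-split b c = trans (Σ-cong (λ i → bit-split (b i) (c i)))
                        (Σ-distrib-+ (bit ∘ (λ i → b i ∧ c i)) (bit ∘ (λ i → b i ∧ not (c i))))
  where
  bit-split : ∀ x y → bit x ≡ bit (x ∧ y) + bit (x ∧ not y)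
  bit-split true  true  = refl
  bit-split true  false = refl
  bit-split false y     = refl

count-update : ∀ {k} (b c : Fin k → Bool) i → (∀ t → t ≢ i → c t ≡ b t) →
               count c + bit (b i) ≡ count b + bit (c i)
count-update {suc k} b c zero c≈b = begin
  bit (c zero) + count (c ∘ suc) + bit (b zero) ≡⟨ cong (λ s → bit (c zero) + s + bit (b zero)) tail-equal ⟩
  bit (c zero) + count (b ∘ suc) + bit (b zero) ≡⟨ xy∙z≈zy∙x (bit (c zero)) _ _ ⟩
  bit (b zero) + count (b ∘ suc) + bit (c zero) ∎
  where
  open ≡-Reasoning
  tail-equal = count-cong (λ t → c≈b (suc t) λ ())
count-update {suc k} b c (suc i) c≈b = begin
  bit (c zero) + count (c ∘ suc) + bit (b (suc i))   ≡⟨ +-assoc (bit (c zero)) _ _ ⟩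
  bit (c zero) + (count (c ∘ suc) + bit (b (suc i))) ≡⟨ cong₂ _+_ (cong bit (c≈b zero λ ())) tail-update ⟩
  bit (b zero) + (count (b ∘ suc) + bit (c (suc i))) ≡⟨ +-assoc (bit (b zero)) _ _ ⟨
  bit (b zero) + count (b ∘ suc) + bit (c (suc i))   ∎
  where
  open ≡-Reasoning
  tail-update = count-update (b ∘ suc) (c ∘ suc) i (λ t t≢i → c≈b (suc t) (t≢i ∘ suc-injective))

count-≟ : ∀ {k} (a : Fin k) → count (λ t → does (t ≟ a)) ≡ 1
count-≟ {suc k} zero    = cong suc (count-none {k} (λ _ → refl))
count-≟ {suc k} (suc a) = count-≟ a

select : ∀ {k} (b : Fin k → Bool) q → q ≤ count b →
         ∃[ c ] (∀ t → c t ≡ true → b t ≡ true) × count c ≡ q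
select {k}     b zero    _  = (λ _ → false) , (λ _ ()) , count-none {k} (λ _ → refl)
select {suc k} b (suc q) q≤ with b zero in b₀
... | true  = let c , c⊆b , #c = select (b ∘ suc) q (≤-pred q≤)
              in  (λ { zero → true ; (suc t) → c t })
                , (λ { zero _ → b₀ ; (suc t) → c⊆b t })
                , cong suc #c
... | false = let c , c⊆b , #c = select (b ∘ suc) (suc q) q≤
              in  (λ { zero → false ; (suc t) → c t }) , (λ { (suc t) → c⊆b t }) , #c

anyᵇ-intro : ∀ {k} (f : Fin k → Bool) {i} → f i ≡ true → anyᵇ f ≡ true
anyᵇ-intro f {zero}  fi rewrite fi = refl
anyᵇ-intro f {suc i} fi with f zero
... | true  = refl
... | false = anyᵇ-intro (f ∘ suc) fi

anyᵇ-elim : ∀ {k} (f : Fin k → Bool) → anyᵇ f ≡ true → ∃[ i ] f i ≡ true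
anyᵇ-elim {suc k} f h with f zero in f₀
... | true  = zero , f₀
... | false = let i , fi = anyᵇ-elim (f ∘ suc) h in suc i , fi

count-atMostOne : ∀ {k} (f : Fin k → Bool) → (∀ {i i′} → f i ≡ true → f i′ ≡ true → i ≡ i′) →
                  count f ≡ bit (anyᵇ f)
count-atMostOne {zero}  f unique = refl
count-atMostOne {suc k} f unique with f zero in f₀
... | true  = cong suc (count-none rest-false)
  where
  rest-false : ∀ i → f (suc i) ≡ false
  rest-false i with f (suc i) in fi
  ... | true  = contradiction (unique f₀ fi) λ ()
  ... | false = refl
... | false = count-atMostOne (f ∘ suc) (λ fi fi′ → suc-injective (unique fi fi′))

sumOn : ∀ {k} → (Fin k → Bool) → (Fin k → ℕ) → ℕ
sumOn R f = Σ[ (λ t → if R t then f t else 0) ]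

module _ {k} {R : Fin k → Bool} {f g : Fin k → ℕ} (f≤g : ∀ t → R t ≡ true → f t ≤ g t) where

  private
    pointwise : ∀ t → (if R t then f t else 0) ≤ (if R t then g t else 0)
    pointwise t with R t in Rt
    ... | true  = f≤g t Rt
    ... | false = z≤n

  sumOn-mono-≤ : sumOn R f ≤ sumOn R g
  sumOn-mono-≤ = Σ-mono-≤ pointwise

  sumOn-mono-< : ∀ {t} → R t ≡ true → f t < g t → sumOn R f < sumOn R g
  sumOn-mono-< {t} Rt ft<gt =
    Σ-mono-< pointwise t (subst (λ b → (if b then f t else 0) < (if b then g t else 0)) (sym Rt) ft<gt)

sumOn-cong : ∀ {k} {R R′ : Fin k → Bool} → R ≗ R′ → (f : Fin k → ℕ) → sumOn R f ≡ sumOn R′ f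
sumOn-cong R≗R′ f = Σ-cong (λ t → cong (λ b → if b then f t else 0) (R≗R′ t))

data SimplePath {k} (_⟶_ : Fin k → Fin k → Set) : Fin k → Fin k → List (Fin k) → Set where
  []   : ∀ {a} → SimplePath _⟶_ a a []
  step : ∀ {a c b vs} → a ⟶ c → SimplePath _⟶_ c b vs → a ∉ c ∷ vs → SimplePath _⟶_ a b (c ∷ vs)

module _ {k} {_⟶_ : Fin k → Fin k → Set} where

  open import Data.List.Membership.DecPropositional (_≟_ {k}) using (_∈?_)

  start∉ : ∀ {a b vs} → SimplePath _⟶_ a b vs → a ∉ vs
  start∉ []             ()
  start∉ (step _ _ a∉) = a∉

  suffixFrom : ∀ {a b c vs} → SimplePath _⟶_ c b vs → a ∈ c ∷ vs → ∃[ ws ] SimplePath _⟶_ a b ws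
  suffixFrom P            (here refl) = _ , P
  suffixFrom (step _ P _) (there a∈)  = suffixFrom P a∈

  shortcut : ∀ {a b} → Star _⟶_ a b → ∃[ vs ] SimplePath _⟶_ a b vs
  shortcut ε = [] , []
  shortcut {a} (a⟶c ◅ c⟶*b) with shortcut c⟶*b
  ... | vs , P with a ∈? _ ∷ vs
  ...   | yes a∈ = suffixFrom P a∈
  ...   | no  a∉ = _ , step a⟶c P a∉

  SimplePath-map : ∀ {_⟶′_ : Fin k → Fin k → Set} {x y a b vs} →
                   (∀ {u v} → x ≢ u → y ≢ v → u ⟶ v → u ⟶′ v) →
                   SimplePath _⟶_ a b vs → x ∉ a ∷ vs → y ∉ vs → SimplePath _⟶′_ a b vs
  SimplePath-map f []                 x∉ y∉ = []
  SimplePath-map f (step a⟶c P a∉) x∉ y∉ =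
    step (f (x∉ ∘ here) (y∉ ∘ here) a⟶c) (SimplePath-map f P (x∉ ∘ there) (y∉ ∘ there)) a∉

Closed : ∀ {k} → (Fin k → Fin k → Set) → (Fin k → Bool) → Set
Closed _⟶_ R = ∀ {u v} → R u ≡ true → u ⟶ v → R v ≡ true

module Search {k} {_⟶_ : Fin k → Fin k → Set} (_⟶?_ : ∀ u v → Dec (u ⟶ v))
              {S T : Fin k → Set} (S? : ∀ v → Dec (S v)) (T? : ∀ v → Dec (T v)) where

  data Outcome : Set where
    path    : ∀ {s t} → S s → T t → Star _⟶_ s t → Outcome
    barrier : (R : Fin k → Bool) → (∀ {s} → S s → R s ≡ true) → Closed _⟶_ R →
              (∀ {t} → R t ≡ true → ¬ T t) → Outcome

  private
    Reachable : (Fin k → Bool) → Set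
    Reachable R = ∀ {v} → R v ≡ true → ∃[ s ] S s × Star _⟶_ s v

    insert : Fin k → (Fin k → Bool) → Fin k → Bool
    insert v R u = does (u ≟ v) ∨ R u

    count-insert : ∀ {v} R → R v ≡ false → count (insert v R) ≡ suc (count R)
    count-insert {v} R Rv = begin
      count (insert v R)                ≡⟨ +-identityʳ _ ⟨
      count (insert v R) + bit false    ≡⟨ cong (λ b → count (insert v R) + bit b) Rv ⟨
      count (insert v R) + bit (R v)    ≡⟨ count-update R (insert v R) v
                                             (λ u u≢v → cong (_∨ R u) (dec-false (u ≟ v) u≢v)) ⟩
      count R + bit (insert v R v)      ≡⟨ cong (λ b → count R + bit (b ∨ R v)) (dec-true (v ≟ v) refl) ⟩
      count R + 1                       ≡⟨ +-comm _ 1 ⟩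
      suc (count R)                     ∎
      where open ≡-Reasoning

    grow : ∀ fuel R → k ≤ count R + fuel → Reachable R → (∀ {s} → S s → R s ≡ true) → Outcome
    grow fuel R bound reach S⊆R with any? (λ t → (R t Bool.≟ true) ×-dec T? t)
    ... | yes (t , Rt , Tt) = let s , Ss , s⟶*t = reach Rt in path Ss Tt s⟶*t
    ... | no no-T
      with any? (λ u → any? (λ v → (R u Bool.≟ true) ×-dec (u ⟶? v) ×-dec (R v Bool.≟ false)))
    ...   | no no-exit = barrier R S⊆R closed (λ Rt Tt → no-T (_ , Rt , Tt))
      where
      closed : Closed _⟶_ R
      closed {u} {v} Ru u⟶v with R v in Rv
      ... | true  = refl
      ... | false = contradiction (u , v , Ru , u⟶v , Rv) no-exit
    ...   | yes (u , v , Ru , u⟶v , Rv) = grow-by-v fuel bound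
      where
      reach′ : Reachable (insert v R)
      reach′ {w} R′w with w ≟ v
      ... | yes refl = let s , Ss , s⟶*u = reach Ru in s , Ss , s⟶*u ◅◅ (u⟶v ◅ ε)
      ... | no  _    = reach R′w

      grow-by-v : ∀ fuel → k ≤ count R + fuel → Outcome
      grow-by-v zero       bound = contradiction (subst (k ≤_) (+-identityʳ _) bound)
                                     (<⇒≱ (subst (_≤ k) (count-insert R Rv) (count≤ (insert v R))))
      grow-by-v (suc fuel) bound = grow fuel (insert v R)
        (subst (k ≤_) (trans (+-suc _ fuel) (cong (_+ fuel) (sym (count-insert R Rv)))) bound)
        reach′ (λ {s} Ss → trans (cong (does (s ≟ v) ∨_) (S⊆R Ss)) (∨-zeroʳ _))

  search : Outcome
  search = grow k (does ∘ S?) (m≤n+m k _) reach₀ (λ {s} Ss → dec-true (S? s) Ss)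
    where
    reach₀ : Reachable (does ∘ S?)
    reach₀ {v} h with S? v
    ... | yes Sv = v , Sv , ε

module Assignments {n k : ℕ} (E : Fin n → Fin k → Bool) (p : Fin n → ℕ) where

  Assignment : Set
  Assignment = Fin n → Fin k → Bool

  load : Assignment → Fin k → ℕ
  load x t = count (λ j → x j t)

  record Valid (x : Assignment) : Set where
    field
      within   : ∀ j t → x j t ≡ true → E j t ≡ true
      rowCount : ∀ j → count (x j) ≡ p j
  open Valid

  Exchange : Assignment → Fin k → Fin k → Set
  Exchange x u v = ∃[ j ] x j u ≡ true × x j v ≡ false × E j v ≡ true

  exchange? : ∀ x u v → Dec (Exchange x u v)
  exchange? x u v = any? (λ j → (x j u Bool.≟ true) ×-dec (x j v Bool.≟ false) ×-dec (E j v Bool.≟ true))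

  δ : Fin k → Fin k → ℕ
  δ a t = bit (does (t ≟ a))

  -- load x′ = load x - 𝟙_a + 𝟙_b, written without subtraction
  MovesLoad : Assignment → Fin k → Fin k → Assignment → Set
  MovesLoad x a b x′ = ∀ t → load x′ t + δ a t ≡ load x t + δ b t

  MovesLoad-trans : ∀ {x y z a b c} → MovesLoad x a c y → MovesLoad y c b z → MovesLoad x a b z
  MovesLoad-trans {x} {y} {z} {a} {b} {c} x↝y y↝z t = +-cancelʳ-≡ (δ c t) _ _ (begin
    load z t + δ a t + δ c t  ≡⟨ xy∙z≈xz∙y (load z t) _ _ ⟩
    load z t + δ c t + δ a t  ≡⟨ cong (_+ δ a t) (y↝z t) ⟩
    load y t + δ b t + δ a t  ≡⟨ xy∙z≈xz∙y (load y t) _ _ ⟩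
    load y t + δ a t + δ b t  ≡⟨ cong (_+ δ b t) (x↝y t) ⟩
    load x t + δ c t + δ b t  ≡⟨ xy∙z≈xz∙y (load x t) _ _ ⟩
    load x t + δ b t + δ c t  ∎)
    where open ≡-Reasoning

  module Move {x j a c} (valid : Valid x) (xja : x j a ≡ true) (xjc : x j c ≡ false) (Ejc : E j c ≡ true) where

    row : Fin k → Bool
    row = updateAt (updateAt (x j) a (const false)) c (const true)

    y : Assignment
    y = updateAt x j (const row)

    private
      a≢c : a ≢ c
      a≢c a≡c = contradiction (trans (sym xja) (trans (cong (x j) a≡c) xjc)) λ ()

      row-c : row c ≡ true
      row-c = updateAt-updates c _

      row-a : row a ≡ false
      row-a = trans (updateAt-minimal a c _ a≢c) (updateAt-updates a (x j))

      row-other : ∀ {t} → t ≢ a → t ≢ c → row t ≡ x j t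
      row-other t≢a t≢c = trans (updateAt-minimal _ c _ t≢c) (updateAt-minimal _ a (x j) t≢a)

      y-j : ∀ t → y j t ≡ row t
      y-j = cong-app (updateAt-updates j x)

      y-other : ∀ {j′} → j′ ≢ j → ∀ t → y j′ t ≡ x j′ t
      y-other j′≢j = cong-app (updateAt-minimal _ j x j′≢j)

      bit-row : ∀ t → bit (row t) + δ a t ≡ bit (x j t) + δ c t
      bit-row t with t ≟ a | t ≟ c
      ... | yes refl | yes a≡c = contradiction a≡c a≢c
      ... | yes refl | no  _   rewrite row-a | xja = refl
      ... | no  _    | yes refl rewrite row-c | xjc = refl
      ... | no  t≢a  | no  t≢c = cong (λ b → bit b + 0) (row-other t≢a t≢c)

      count-row : count row ≡ count (x j)
      count-row = +-cancelʳ-≡ 1 _ _ (begin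
        count row + 1                       ≡⟨ cong (count row +_) (count-≟ a) ⟨
        count row + Σ[ δ a ]                ≡⟨ Σ-distrib-+ (bit ∘ row) (δ a) ⟨
        Σ[ (λ t → bit (row t) + δ a t) ]    ≡⟨ Σ-cong bit-row ⟩
        Σ[ (λ t → bit (x j t) + δ c t) ]    ≡⟨ Σ-distrib-+ (bit ∘ x j) (δ c) ⟩
        count (x j) + Σ[ δ c ]              ≡⟨ cong (count (x j) +_) (count-≟ c) ⟩
        count (x j) + 1                     ∎)
        where open ≡-Reasoning

    valid-y : Valid y
    valid-y = record { within = within-y ; rowCount = rowCount-y }
      where
      within-row : ∀ t → row t ≡ true → E j t ≡ true
      within-row t rt with t ≟ c | t ≟ a
      ... | yes refl | _        = Ejc
      ... | no  _    | yes refl = contradiction (trans (sym rt) row-a) λ ()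
      ... | no  t≢c  | no  t≢a  = within valid j t (trans (sym (row-other t≢a t≢c)) rt)

      within-y : ∀ j′ t → y j′ t ≡ true → E j′ t ≡ true
      within-y j′ t yt with j′ ≟ j
      ... | yes refl = within-row t (trans (sym (y-j t)) yt)
      ... | no  j′≢j = within valid j′ t (trans (sym (y-other j′≢j t)) yt)

      rowCount-y : ∀ j′ → count (y j′) ≡ p j′
      rowCount-y j′ with j′ ≟ j
      ... | yes refl = trans (count-cong y-j) (trans count-row (rowCount valid j))
      ... | no  j′≢j = trans (count-cong (y-other j′≢j)) (rowCount valid j′)

    moves-y : MovesLoad x a c y
    moves-y t = +-cancelʳ-≡ (bit (x j t)) _ _ (begin
      load y t + δ a t + bit (x j t)    ≡⟨ xy∙z≈xz∙y (load y t) _ _ ⟩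
      load y t + bit (x j t) + δ a t    ≡⟨ cong (_+ δ a t) column ⟩
      load x t + bit (row t) + δ a t    ≡⟨ +-assoc (load x t) _ _ ⟩
      load x t + (bit (row t) + δ a t)  ≡⟨ cong (load x t +_) (bit-row t) ⟩
      load x t + (bit (x j t) + δ c t)  ≡⟨ x∙yz≈xz∙y (load x t) _ _ ⟩
      load x t + δ c t + bit (x j t)    ∎)
      where
      open ≡-Reasoning
      column : load y t + bit (x j t) ≡ load x t + bit (row t)
      column = trans (count-update (λ j′ → x j′ t) (λ j′ → y j′ t) j (λ j′ j′≢j → y-other j′≢j t))
                     (cong (λ b → load x t + bit b) (y-j t))

    exchange-y : ∀ {u v} → a ≢ u → c ≢ v → Exchange x u v → Exchange y u v
    exchange-y {u} {v} a≢u c≢v (j′ , xj′u , xj′v , Ej′v) = j′ , keeps-true , keeps-false , Ej′v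
      where
      keeps-true : y j′ u ≡ true
      keeps-true with j′ ≟ j | u ≟ c
      ... | no  j′≢j | _        = trans (y-other j′≢j u) xj′u
      ... | yes refl | yes refl = trans (y-j c) row-c
      ... | yes refl | no  u≢c  = trans (y-j u) (trans (row-other (a≢u ∘ sym) u≢c) xj′u)

      keeps-false : y j′ v ≡ false
      keeps-false with j′ ≟ j | v ≟ a
      ... | no  j′≢j | _        = trans (y-other j′≢j v) xj′v
      ... | yes refl | yes refl = trans (y-j a) row-a
      ... | yes refl | no  v≢a  = trans (y-j v) (trans (row-other v≢a (c≢v ∘ sym)) xj′v)

  augment : ∀ {x a b vs} → Valid x → SimplePath (Exchange x) a b vs →
            ∃[ x′ ] Valid x′ × MovesLoad x a b x′
  augment {x} valid [] = x , valid , λ t → refl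
  -- The rest of the path avoids a and meets c only at its start, so its edges survive the move.
  augment valid (step (j , xja , xjc , Ejc) P a∉) =
    let open Move valid xja xjc Ejc
        x′ , valid′ , y↝x′ = augment valid-y (SimplePath-map exchange-y P a∉ (start∉ P))
    in  x′ , valid′ , MovesLoad-trans moves-y y↝x′

  countIn countOut : (Fin k → Bool) → (Fin k → Bool) → ℕ
  countIn  b R = count (λ t → b t ∧ R t)
  countOut b R = count (λ t → b t ∧ not (R t))

  fvOf : (Fin k → Bool) → ℕ
  fvOf R = Σ[ (λ j → p j ∸ countOut (E j) R) ]

  pvOf : (Fin k → Bool) → ℕ
  pvOf R = Σ[ (λ j → p j ⊓ countIn (E j) R) ]

  fvOf-cong : ∀ {R R′} → R ≗ R′ → fvOf R ≡ fvOf R′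
  fvOf-cong R≗R′ = Σ-cong (λ j → cong (p j ∸_) (count-cong (λ t → cong (λ b → E j t ∧ not b) (R≗R′ t))))

  pvOf-cong : ∀ {R R′} → R ≗ R′ → pvOf R ≡ pvOf R′
  pvOf-cong R≗R′ = Σ-cong (λ j → cong (p j ⊓_) (count-cong (λ t → cong (E j t ∧_) (R≗R′ t))))

  sumOn-load : ∀ x R → sumOn R (load x) ≡ Σ[ (λ j → countIn (x j) R) ]
  sumOn-load x R = trans (Σ-cong column) (Σ-swap (λ t j → bit (x j t ∧ R t)))
    where
    column : ∀ t → (if R t then load x t else 0) ≡ count (λ j → x j t ∧ R t)
    column t with R t
    ... | true  = count-cong (λ j → sym (∧-identityʳ (x j t)))
    ... | false = sym (count-none (λ j → ∧-zeroʳ (x j t)))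

  module _ {x} (valid : Valid x) (R : Fin k → Bool) (j : Fin n) where

    countIn≡p∸countOut : countIn (x j) R ≡ p j ∸ countOut (x j) R
    countIn≡p∸countOut = begin
      countIn (x j) R                                       ≡⟨ m+n∸n≡m _ (countOut (x j) R) ⟨
      countIn (x j) R + countOut (x j) R ∸ countOut (x j) R ≡⟨ cong (_∸ countOut (x j) R) (count-split (x j) R) ⟨
      count (x j) ∸ countOut (x j) R                        ≡⟨ cong (_∸ countOut (x j) R) (rowCount valid j) ⟩
      p j ∸ countOut (x j) R                                ∎
      where open ≡-Reasoning

    forced≤countIn : p j ∸ countOut (E j) R ≤ countIn (x j) R
    forced≤countIn = ≤-trans (∸-monoʳ-≤ (p j) (count-mono x∧¬R⊆E∧¬R))
                             (≤-reflexive (sym countIn≡p∸countOut))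
      where
      x∧¬R⊆E∧¬R : ∀ t → x j t ∧ not (R t) ≡ true → E j t ∧ not (R t) ≡ true
      x∧¬R⊆E∧¬R t h = cong₂ _∧_ (within valid j t (∧-conicalˡ _ _ h)) (∧-conicalʳ _ _ h)

    countIn≤possible : countIn (x j) R ≤ p j ⊓ countIn (E j) R
    countIn≤possible = ⊓-glb (≤-trans (count-mono {c = x j} (λ t → ∧-conicalˡ _ _))
                                      (≤-reflexive (rowCount valid j)))
                             (count-mono x∧R⊆E∧R)
      where
      x∧R⊆E∧R : ∀ t → x j t ∧ R t ≡ true → E j t ∧ R t ≡ true
      x∧R⊆E∧R t h = cong₂ _∧_ (within valid j t (∧-conicalˡ _ _ h)) (∧-conicalʳ _ _ h)

    countIn≤forced : Closed (Exchange x) R → countIn (x j) R ≤ p j ∸ countOut (E j) R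
    countIn≤forced closed with any? (λ v → (x j v Bool.≟ true) ×-dec (R v Bool.≟ true))
    ... | no  nowhere = ≤-trans (≤-reflexive (count-none x∧R-false)) z≤n
      where
      x∧R-false : ∀ t → x j t ∧ R t ≡ false
      x∧R-false t with x j t in xjt | R t in Rt
      ... | true  | true  = contradiction (t , xjt , Rt) nowhere
      ... | true  | false = refl
      ... | false | _     = refl
    ... | yes (v , xjv , Rv) =
      ≤-trans (≤-reflexive countIn≡p∸countOut) (∸-monoʳ-≤ (p j) (count-mono E∧¬R⊆x∧¬R))
      where
      E∧¬R⊆x∧¬R : ∀ w → E j w ∧ not (R w) ≡ true → x j w ∧ not (R w) ≡ true
      E∧¬R⊆x∧¬R w h with x j w in xjw
      ... | true  = ∧-conicalʳ _ _ h
      ... | false = contradiction (closed Rv (j , xjv , xjw , ∧-conicalˡ _ _ h))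
                                  (λ Rw → contradiction (trans (sym (cong not Rw)) (∧-conicalʳ _ _ h)) λ ())

    possible≤countIn : Closed (flip (Exchange x)) R → p j ⊓ countIn (E j) R ≤ countIn (x j) R
    possible≤countIn closed
      with any? (λ w → (E j w Bool.≟ true) ×-dec (x j w Bool.≟ false) ×-dec (R w Bool.≟ true))
    ... | yes (w , Ejw , xjw , Rw) =
      ≤-trans (m⊓n≤m _ _) (≤-trans (≤-reflexive (sym (rowCount valid j)))
              (count-mono {b = x j} (λ v xjv → cong₂ _∧_ xjv (closed Rw (j , xjv , xjw , Ejw)))))
    ... | no nowhere = ≤-trans (m⊓n≤n _ _) (count-mono E∧R⊆x∧R)
      where
      E∧R⊆x∧R : ∀ w → E j w ∧ R w ≡ true → x j w ∧ R w ≡ true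
      E∧R⊆x∧R w h with x j w in xjw
      ... | true  = ∧-conicalʳ _ _ h
      ... | false = contradiction (w , ∧-conicalˡ _ _ h , xjw , ∧-conicalʳ _ _ h) nowhere

  module _ {x} (valid : Valid x) (R : Fin k → Bool) where

    fv≤sumOn-load : fvOf R ≤ sumOn R (load x)
    fv≤sumOn-load = ≤-trans (Σ-mono-≤ (forced≤countIn valid R)) (≤-reflexive (sym (sumOn-load x R)))

    sumOn-load≤pv : sumOn R (load x) ≤ pvOf R
    sumOn-load≤pv = ≤-trans (≤-reflexive (sumOn-load x R)) (Σ-mono-≤ (countIn≤possible valid R))

    sumOn-load≤fv : Closed (Exchange x) R → sumOn R (load x) ≤ fvOf R
    sumOn-load≤fv closed =
      ≤-trans (≤-reflexive (sumOn-load x R)) (Σ-mono-≤ (λ j → countIn≤forced valid R j closed))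

    pv≤sumOn-load : Closed (flip (Exchange x)) R → pvOf R ≤ sumOn R (load x)
    pv≤sumOn-load closed =
      ≤-trans (Σ-mono-≤ (λ j → possible≤countIn valid R j closed)) (≤-reflexive (sym (sumOn-load x R)))

  module _ {x x′ a b} (a≢b : a ≢ b) (moves : MovesLoad x a b x′) where

    private
      δ-self : ∀ t → δ t t ≡ 1
      δ-self t = cong bit (dec-true (t ≟ t) refl)

      δ-other : ∀ {t u} → t ≢ u → δ u t ≡ 0
      δ-other {t} {u} t≢u = cong bit (dec-false (t ≟ u) t≢u)

    MovesLoad-source : suc (load x′ a) ≡ load x a
    MovesLoad-source = begin
      suc (load x′ a)     ≡⟨ +-comm 1 _ ⟩
      load x′ a + 1       ≡⟨ cong (load x′ a +_) (δ-self a) ⟨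
      load x′ a + δ a a   ≡⟨ moves a ⟩
      load x a + δ b a    ≡⟨ cong (load x a +_) (δ-other a≢b) ⟩
      load x a + 0        ≡⟨ +-identityʳ _ ⟩
      load x a            ∎
      where open ≡-Reasoning

    MovesLoad-target : load x′ b ≡ suc (load x b)
    MovesLoad-target = begin
      load x′ b           ≡⟨ +-identityʳ _ ⟨
      load x′ b + 0       ≡⟨ cong (load x′ b +_) (δ-other (a≢b ∘ sym)) ⟨
      load x′ b + δ a b   ≡⟨ moves b ⟩
      load x b + δ b b    ≡⟨ cong (load x b +_) (δ-self b) ⟩
      load x b + 1        ≡⟨ +-comm _ 1 ⟩
      suc (load x b)      ∎
      where open ≡-Reasoning

    MovesLoad-other : ∀ {t} → t ≢ a → t ≢ b → load x′ t ≡ load x t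
    MovesLoad-other {t} t≢a t≢b = +-cancelʳ-≡ 0 _ _ (begin
      load x′ t + 0       ≡⟨ cong (load x′ t +_) (δ-other t≢a) ⟨
      load x′ t + δ a t   ≡⟨ moves t ⟩
      load x t + δ b t    ≡⟨ cong (load x t +_) (δ-other t≢b) ⟩
      load x t + 0        ∎)
      where open ≡-Reasoning

  module Balancing (lo hi : Fin k → ℕ) (lo≤hi : ∀ t → lo t ≤ hi t) where

    DefCondition ExcCondition : Set
    DefCondition = ∀ R → fvOf R ≤ sumOn R hi
    ExcCondition = ∀ R → sumOn R lo ≤ pvOf R

    excess deficit : Assignment → ℕ
    excess  x = Σ[ (λ t → load x t ∸ hi t) ]
    deficit x = Σ[ (λ t → lo t ∸ load x t) ]

    module _ {x x′ s b} (moves : MovesLoad x s b x′) (hi<s : hi s < load x s) (b<hi : load x b < hi b) where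

      private
        s≢b : s ≢ b
        s≢b refl = <-asym hi<s b<hi

        source : suc (load x′ s) ≡ load x s
        source = MovesLoad-source s≢b moves

        target : load x′ b ≡ suc (load x b)
        target = MovesLoad-target s≢b moves

        excess-pointwise : ∀ t → load x′ t ∸ hi t ≤ load x t ∸ hi t
        excess-pointwise t with t ≟ s | t ≟ b
        ... | yes refl | _        = ∸-monoˡ-≤ (hi t) (≤-trans (n≤1+n _) (≤-reflexive source))
        ... | no  _    | yes refl = ≤-trans (≤-reflexive (m≤n⇒m∸n≡0 (subst (_≤ hi t) (sym target) b<hi))) z≤n
        ... | no  t≢s  | no  t≢b  = ≤-reflexive (cong (_∸ hi t) (MovesLoad-other s≢b moves t≢s t≢b))

      excess-decreases : excess x′ < excess x
      excess-decreases = Σ-mono-< excess-pointwise s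
        (∸-monoˡ-< (≤-reflexive source) (≤-pred (subst (hi s <_) (sym source) hi<s)))

    module _ {x x′ b s} (moves : MovesLoad x b s x′) (s<lo : load x s < lo s) (lo<b : lo b < load x b) where

      private
        b≢s : b ≢ s
        b≢s refl = <-asym s<lo lo<b

        source : suc (load x′ b) ≡ load x b
        source = MovesLoad-source b≢s moves

        target : load x′ s ≡ suc (load x s)
        target = MovesLoad-target b≢s moves

        deficit-pointwise : ∀ t → lo t ∸ load x′ t ≤ lo t ∸ load x t
        deficit-pointwise t with t ≟ b | t ≟ s
        ... | yes refl | _        =
          ≤-trans (≤-reflexive (m≤n⇒m∸n≡0 (≤-pred (subst (lo t <_) (sym source) lo<b)))) z≤n
        ... | no  _    | yes refl = ∸-monoʳ-≤ (lo t) (≤-trans (n≤1+n _) (≤-reflexive (sym target)))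
        ... | no  t≢b  | no  t≢s  = ≤-reflexive (cong (lo t ∸_) (MovesLoad-other b≢s moves t≢b t≢s))

      deficit-decreases : deficit x′ < deficit x
      deficit-decreases = Σ-mono-< deficit-pointwise s
        (subst (λ l → lo s ∸ l < lo s ∸ load x s) (sym target) (∸-monoʳ-< ≤-refl s<lo))

      ≤hi-preserved : (∀ t → load x t ≤ hi t) → ∀ t → load x′ t ≤ hi t
      ≤hi-preserved ≤hi t with t ≟ b | t ≟ s
      ... | yes refl | _        = ≤-trans (≤-trans (n≤1+n _) (≤-reflexive source)) (≤hi t)
      ... | no  _    | yes refl = ≤-trans (≤-reflexive target) (≤-trans s<lo (lo≤hi t))
      ... | no  t≢b  | no  t≢s  = ≤-trans (≤-reflexive (MovesLoad-other b≢s moves t≢b t≢s)) (≤hi t)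

    initial : DefCondition → ∃[ x ] Valid x
    initial def = (λ j → proj₁ (chosen j)) , record
      { within   = λ j t h → ∧-conicalˡ _ _ (proj₁ (proj₂ (chosen j)) t h)
      ; rowCount = λ j → proj₂ (proj₂ (chosen j)) }
      where
      p≤|E| : ∀ j → p j ≤ countOut (E j) (λ _ → false)
      p≤|E| = Σ∸≤0⇒≤ p (λ j → countOut (E j) (λ _ → false))
                       (≤-trans (def (λ _ → false)) (≤-reflexive (Σ-zero {k})))

      chosen : ∀ j → ∃[ c ] (∀ t → c t ≡ true → E j t ∧ not false ≡ true) × count c ≡ p j
      chosen j = select _ (p j) (p≤|E| j)

    fitUpper : DefCondition → ∀ fuel x → Valid x → excess x ≤ fuel →
               ∃[ x′ ] Valid x′ × (∀ t → load x′ t ≤ hi t)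
    fitUpper def zero x valid none = x , valid , Σ∸≤0⇒≤ (load x) hi none
    fitUpper def (suc fuel) x valid bound
      with Search.search (exchange? x) (λ t → hi t <? load x t) (λ t → load x t <? hi t)
    ... | Search.path over under s⟶*b =
      let x′ , valid′ , moves = augment valid (proj₂ (shortcut s⟶*b))
      in  fitUpper def fuel x′ valid′ (≤-pred (≤-trans (excess-decreases moves over under) bound))
    -- An overloaded slot would lie in the closed set R and make R violate the def-condition.
    ... | Search.barrier R over⊆R closed ¬under =
      x , valid , λ t → ≮⇒≥ (λ over → ≤⇒≯ (def R) (violation over))
      where
      violation : ∀ {t} → hi t < load x t → sumOn R hi < fvOf R
      violation over = <-≤-trans (sumOn-mono-< {R = R} (λ t Rt → ≮⇒≥ (¬under Rt)) (over⊆R over) over)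
                                 (sumOn-load≤fv valid R closed)

    fitLower : ExcCondition → ∀ fuel x → Valid x → (∀ t → load x t ≤ hi t) → deficit x ≤ fuel →
               ∃[ x′ ] Valid x′ × (∀ t → lo t ≤ load x′ t) × (∀ t → load x′ t ≤ hi t)
    fitLower exc zero x valid ≤hi none =
      x , valid , Σ∸≤0⇒≤ lo (load x) none , ≤hi
    fitLower exc (suc fuel) x valid ≤hi bound
      with Search.search (flip (exchange? x)) (λ t → load x t <? lo t) (λ t → lo t <? load x t)
    ... | Search.path under over s⟵*b =
      let x′ , valid′ , moves = augment valid (proj₂ (shortcut (reverse id s⟵*b)))
      in  fitLower exc fuel x′ valid′ (≤hi-preserved moves under over ≤hi)
                   (≤-pred (≤-trans (deficit-decreases moves under over) bound))
    ... | Search.barrier R under⊆R closed ¬over =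
      x , valid , (λ t → ≮⇒≥ (λ under → ≤⇒≯ (exc R) (violation under))) , ≤hi
      where
      violation : ∀ {t} → load x t < lo t → pvOf R < sumOn R lo
      violation under = ≤-<-trans (pv≤sumOn-load valid R closed)
                                  (sumOn-mono-< {R = R} (λ t Rt → ≮⇒≥ (¬over Rt)) (under⊆R under) under)

    Balanced : Set
    Balanced = ∃[ x ] Valid x × (∀ t → lo t ≤ load x t) × (∀ t → load x t ≤ hi t)

    balance : DefCondition → ExcCondition → Balanced
    balance def exc =
      let x₀ , valid₀ = initial def
          x₁ , valid₁ , ≤hi₁ = fitUpper def (excess x₀) x₀ valid₀ ≤-refl
      in  fitLower exc (deficit x₁) x₁ valid₁ ≤hi₁ ≤-refl

    Balanced⇔conditions : Balanced ⇔ (DefCondition × ExcCondition)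
    Balanced⇔conditions = mk⇔ necessary (λ (def , exc) → balance def exc)
      where
      necessary : Balanced → DefCondition × ExcCondition
      necessary (x , valid , lo≤ , ≤hi) =
          (λ R → ≤-trans (fv≤sumOn-load valid R) (sumOn-mono-≤ (λ t _ → ≤hi t)))
        , (λ R → ≤-trans (sumOn-mono-≤ (λ t _ → lo≤ t)) (sumOn-load≤pv valid R))

record Packing {n m} (b : Fin n → Bool) (f : Fin m → Maybe (Fin n)) : Set where
  field
    sound     : ∀ {i j} → f i ≡ just j → b j ≡ true
    injective : ∀ {i i′ j} → f i ≡ just j → f i′ ≡ just j → i ≡ i′
    complete  : ∀ {j} → b j ≡ true → ∃[ i ] f i ≡ just j
    busy      : count (is-just ∘ f) ≡ count b

module _ {n m} {b : Fin (suc n) → Bool} {f : Fin m → Maybe (Fin n)} (P : Packing (b ∘ suc) f) where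

  open Packing P

  private
    shifted : Fin m → Maybe (Fin (suc n))
    shifted = Maybe.map suc ∘ f

    unshift : ∀ {i j} → shifted i ≡ just j → ∃[ j′ ] j ≡ suc j′ × f i ≡ just j′
    unshift {i} e with f i
    unshift refl | just j′ = j′ , refl , refl

    shifted-sound : ∀ {i j} → shifted i ≡ just j → b j ≡ true
    shifted-sound e with unshift e
    ... | _ , refl , fi = sound fi

    shifted-injective : ∀ {i i′ j} → shifted i ≡ just j → shifted i′ ≡ just j → i ≡ i′
    shifted-injective e e′ with unshift e | unshift e′
    ... | _ , refl , fi | _ , j≡ , fi′ =
      injective fi (subst (λ j → f _ ≡ just j) (suc-injective (sym j≡)) fi′)

    shifted-complete : ∀ {j} → b (suc j) ≡ true → ∃[ i ] shifted i ≡ just (suc j)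
    shifted-complete bj = let i , fi = complete bj in i , cong (Maybe.map suc) fi

    shifted-busy : count (is-just ∘ shifted) ≡ count (b ∘ suc)
    shifted-busy = trans (count-cong (λ i → is-just-map (f i))) busy
      where
      is-just-map : ∀ (mj : Maybe (Fin n)) → is-just (Maybe.map suc mj) ≡ is-just mj
      is-just-map nothing  = refl
      is-just-map (just _) = refl

  Packing-skip : b zero ≡ false → Packing b shifted
  Packing-skip b₀ = record
    { sound     = shifted-sound
    ; injective = shifted-injective
    ; complete  = λ { {zero} bj → contradiction (trans (sym b₀) bj) λ () ; {suc j} → shifted-complete }
    ; busy      = trans shifted-busy (sym (cong (λ c → bit c + count (b ∘ suc)) b₀))
    }

  Packing-take : b zero ≡ true → Packing b (λ { zero → just zero ; (suc i) → shifted i })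
  Packing-take b₀ = record
    { sound     = λ { {zero} refl → b₀ ; {suc i} → shifted-sound }
    ; injective = λ { {zero} {zero} _ _ → refl
                    ; {zero} {suc i′} refl e′ → ⊥-elim (zero≢shifted e′)
                    ; {suc i} {zero} e refl → ⊥-elim (zero≢shifted e)
                    ; {suc i} {suc i′} e e′ → cong suc (shifted-injective e e′) }
    ; complete  = λ { {zero} _ → zero , refl ; {suc j} bj → let i , e = shifted-complete bj in suc i , e }
    ; busy      = trans (cong suc shifted-busy) (sym (cong (λ c → bit c + count (b ∘ suc)) b₀))
    }
    where
    zero≢shifted : ∀ {i} → shifted i ≢ just zero
    zero≢shifted e with unshift e
    ... | _ , () , _

pack : ∀ {n m} (b : Fin n → Bool) → count b ≤ m → ∃ λ (f : Fin m → Maybe (Fin n)) → Packing b f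
pack {zero} {m}  b _ = (λ _ → nothing) , record
  { sound = λ () ; injective = λ () ; complete = λ { {()} } ; busy = count-none {m} (λ _ → refl) }
pack {suc n} {m} b #b≤m with b zero in b₀ | m
... | false | m′     = let _ , P = pack {m = m′} (b ∘ suc) #b≤m in _ , Packing-skip P b₀
... | true  | suc m′ = let _ , P = pack {m = m′} (b ∘ suc) (≤-pred #b≤m) in _ , Packing-take P b₀

module _ (I : Instance) where

  open Instance I
  open Assignments (inEᵇ I) p
  open Balancing lo hi lo≤hi
  open Valid

  private
    inE-intro : ∀ {j t} → r j ≤ toℕ t → toℕ t ≤ dl j → inEᵇ I j t ≡ true
    inE-intro r≤t t≤d = cong₂ _∧_ (Equivalence.to T-≡ (≤⇒≤ᵇ r≤t)) (Equivalence.to T-≡ (≤⇒≤ᵇ t≤d))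

    inE-elim : ∀ {j t} → inEᵇ I j t ≡ true → r j ≤ toℕ t × toℕ t ≤ dl j
    inE-elim h = ≤ᵇ⇒≤ _ _ (Equivalence.from T-≡ (∧-conicalˡ _ _ h))
               , ≤ᵇ⇒≤ _ _ (Equivalence.from T-≡ (∧-conicalʳ _ _ h))

    matches : Fin n → Maybe (Fin n) → Bool
    matches j = maybe (λ j′ → does (j ≟ j′)) false

    matches-just : ∀ {j} mj → matches j mj ≡ true → mj ≡ just j
    matches-just {j} (just j′) h with j ≟ j′
    ... | yes refl = refl

    is-just≡count-matches : ∀ mj → bit (is-just mj) ≡ count (λ j → matches j mj)
    is-just≡count-matches nothing   = sym (count-none {n} (λ _ → refl))
    is-just≡count-matches (just j₀) = sym (count-≟ j₀)

  module _ {S : Schedule I} (feasible : FeasibleSchedule I S) where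

    open FeasibleSchedule feasible

    runs-valid : Valid (runsᵇ I S)
    runs-valid = record { within = within-runs ; rowCount = volume }
      where
      within-runs : ∀ j t → runsᵇ I S j t ≡ true → inEᵇ I j t ≡ true
      within-runs j t h = let i , e = anyᵇ-elim (λ i → matches j (S i t)) h
                              r≤t , t≤d = inWindow i t j (matches-just (S i t) e)
                          in  inE-intro r≤t t≤d

    load-runs : ∀ t → load (runsᵇ I S) t ≡ vol I S t
    load-runs t = sym (begin
      vol I S t                                     ≡⟨ Σ-cong (λ i → is-just≡count-matches (S i t)) ⟩
      Σ[ (λ i → count (λ j → matches j (S i t))) ]  ≡⟨ Σ-swap (λ i j → bit (matches j (S i t))) ⟩
      Σ[ (λ j → count (λ i → matches j (S i t))) ]  ≡⟨ Σ-cong (λ j → count-atMostOne _ (one-processor j)) ⟩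
      load (runsᵇ I S) t                            ∎)
      where
      open ≡-Reasoning
      one-processor : ∀ j {i i′} → matches j (S i t) ≡ true → matches j (S i′ t) ≡ true → i ≡ i′
      one-processor j e e′ = noParallel t _ _ j (matches-just _ e) (matches-just _ e′)

  module _ {x} (valid : Valid x) (≤hi : ∀ t → load x t ≤ hi t) where

    private
      packing : ∀ t → ∃ (Packing (λ j → x j t))
      packing t = pack (λ j → x j t) (≤-trans (≤hi t) (hi≤m t))

      module P t = Packing (proj₂ (packing t))

    schedule : Schedule I
    schedule i t = proj₁ (packing t) i

    runs-schedule : ∀ j t → runsᵇ I schedule j t ≡ x j t
    runs-schedule j t = ⇔→≡ (mk⇔ runs⇒x x⇒runs)
      where
      runs⇒x : runsᵇ I schedule j t ≡ true → x j t ≡ true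
      runs⇒x h = let i , e = anyᵇ-elim (λ i → matches j (schedule i t)) h in P.sound t (matches-just _ e)

      x⇒runs : x j t ≡ true → runsᵇ I schedule j t ≡ true
      x⇒runs xjt = let i , e = P.complete t xjt in
                   anyᵇ-intro (λ i → matches j (schedule i t))
                              (trans (cong (matches j) e) (dec-true (j ≟ j) refl))

    schedule-feasible : (∀ t → lo t ≤ load x t) → FeasibleSchedule I schedule
    schedule-feasible lo≤ = record
      { noParallel = λ t i i′ j → P.injective t
      ; inWindow   = λ i t j e → inE-elim (within valid j t (P.sound t e))
      ; volume     = λ j → trans (count-cong (runs-schedule j)) (rowCount valid j)
      ; lowerBound = λ t → ≤-trans (lo≤ t) (≤-reflexive (sym (P.busy t)))
      ; upperBound = λ t → ≤-trans (≤-reflexive (P.busy t)) (≤hi t)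
      }

  Feasible⇔Balanced : Feasible I ⇔ Balanced
  Feasible⇔Balanced = mk⇔
    (λ (S , feasible) → runsᵇ I S , runs-valid feasible
                      , (λ t → ≤-trans (lowerBound feasible t) (≤-reflexive (sym (load-runs feasible t))))
                      , (λ t → ≤-trans (≤-reflexive (load-runs feasible t)) (upperBound feasible t)))
    (λ (x , valid , lo≤ , ≤hi) → schedule valid ≤hi , schedule-feasible valid ≤hi lo≤)
    where open FeasibleSchedule

  Feasible⇔conditions : Feasible I ⇔ (DefCondition × ExcCondition)
  Feasible⇔conditions = ⇔-trans Feasible⇔Balanced Balanced⇔conditions

  conditions⇔subsets : (DefCondition × ExcCondition) ⇔ (∀ (Q : Subset (suc d)) → def≤0 I Q × exc≤0 I Q)
  conditions⇔subsets = mk⇔ (λ (def , exc) Q → def (lookup Q) , exc (lookup Q)) (λ H → def H , exc H)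
    where
    module _ (H : ∀ (Q : Subset (suc d)) → def≤0 I Q × exc≤0 I Q) (R : Slot I → Bool) where
      R≗ : lookup (tabulate R) ≗ R
      R≗ = lookup∘tabulate R

      def : fvOf R ≤ sumOn R hi
      def = subst₂ _≤_ (fvOf-cong R≗) (sumOn-cong R≗ hi) (proj₁ (H (tabulate R)))

      exc : sumOn R lo ≤ pvOf R
      exc = subst₂ _≤_ (sumOn-cong R≗ lo) (pvOf-cong R≗) (proj₂ (H (tabulate R)))

lemma4 : (I : Instance) →
    Feasible I ⇔ (∀ (Q : Subset (suc (Instance.d I))) → def≤0 I Q × exc≤0 I Q)
lemma4 I = ⇔-trans (Feasible⇔conditions I) (conditions⇔subsets I)
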